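{- Let $i,j\ge1$. Then \[ \frac{\partial\phi_{i,j}}{\partial f_{(\circ)}}=i\,\phi_{i+1,j},\qquad\frac{\partial\phi_{i,j}}{\partial f_{(\bullet)}}=j\,w\,\phi_{i,j+1},\qquad\frac{\partial\phi_i}{\partial f_{(\bullet)}}=i\,\phi_{i+1}. \]
   Context: For $k\ge1$, $\phi(v,x_1,\dots,x_k)=\sum_{n\ge k}h_{n-k}(x_1,\dots,x_k)\frac{v^n}{n!}$ with $h_m$ the complete homogeneous symmetric polynomial, and $\phi(v)=1$. $f_{(\circ)},f_{(\bullet)},w,v,y$ are indeterminates. $\phi_{i,j}=\phi_{i,j}(v)$ is $\phi(v,x_1,\dots,x_{i+j})$ with $i$ of the arguments $x$ set to $f_{(\circ)}$ and $j$ of them set to $wf_{(\bullet)}$ (well defined by symmetry). $\phi_i=\phi_i(y)$ is $\phi(y,x_1,\dots,x_i)$ with all $x_m=f_{(\bullet)}$. -}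

module Defs where

open import Data.Nat as ℕ using (ℕ; zero; suc; _∸_; _≤ᵇ_)
open import Data.Integer using (ℤ; +_; _+_; _*_)
open import Data.List using (List; []; _∷_; length; replicate; _++_)
open import Data.Bool using (if_then_else_)
open import Relation.Binary.PropositionalEquality using (_≡_)

-- Polynomials (formal) in three commuting indeterminates
--   X = f_(∘),  Y = f_(•),  W = w
-- with integer coefficients, represented by their coefficient function:
--   p a b c = coefficient of X^a Y^b W^c.
Poly : Set
Poly = ℕ → ℕ → ℕ → ℤ

_≋_ : Poly → Poly → Set
p ≋ q = ∀ a b c → p a b c ≡ q a b c

infix 4 _≋_

sumTo : (ℕ → ℤ) → ℕ → ℤ
sumTo f zero    = f zero
sumTo f (suc m) = sumTo f m + f (suc m)

0ₚ : Poly
0ₚ _ _ _ = + 0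

1ₚ : Poly
1ₚ zero zero zero = + 1
1ₚ _    _    _    = + 0

Xₚ : Poly
Xₚ 1 0 0 = + 1
Xₚ _ _ _ = + 0

Yₚ : Poly
Yₚ 0 1 0 = + 1
Yₚ _ _ _ = + 0

Wₚ : Poly
Wₚ 0 0 1 = + 1
Wₚ _ _ _ = + 0

_*ₚ_ : Poly → Poly → Poly
(p *ₚ q) a b c =
  sumTo (λ a₁ → sumTo (λ b₁ → sumTo (λ c₁ →
    p a₁ b₁ c₁ * q (a ∸ a₁) (b ∸ b₁) (c ∸ c₁)) c) b) a

_·ₚ_ : ℕ → Poly → Poly
(k ·ₚ p) a b c = + k * p a b c

_^ₚ_ : Poly → ℕ → Poly
p ^ₚ zero  = 1ₚ
p ^ₚ suc n = p *ₚ (p ^ₚ n)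

sumPoly : (ℕ → Poly) → ℕ → Poly
sumPoly F m a b c = sumTo (λ t → F t a b c) m

h : ℕ → List Poly → Poly
h zero    []       = 1ₚ
h (suc m) []       = 0ₚ
h m       (x ∷ xs) = sumPoly (λ t → (x ^ₚ t) *ₚ h (m ∸ t) xs) m

-- Formal power series in one variable (v or y) over Poly, given by
-- exponential coefficients: S n = coefficient of v^n / n!.
Series : Set
Series = ℕ → Poly

_≋ₛ_ : Series → Series → Set
S ≋ₛ T = ∀ n → S n ≋ T n

infix 4 _≋ₛ_

φ : List Poly → Series
φ xs n = if length xs ≤ᵇ n then h (n ∸ length xs) xs else 0ₚ

φ₂ : ℕ → ℕ → Series
φ₂ i j = φ (replicate i Xₚ ++ replicate j (Wₚ *ₚ Yₚ))

φ₁ : ℕ → Series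
φ₁ i = φ (replicate i Yₚ)

∂X : Poly → Poly
∂X p a b c = + suc a * p (suc a) b c

∂Y : Poly → Poly
∂Y p a b c = + suc b * p a (suc b) c

∂Xₛ ∂Yₛ : Series → Series
∂Xₛ S n = ∂X (S n)
∂Yₛ S n = ∂Y (S n)

_·ₛ_ : ℕ → Series → Series
(k ·ₛ S) n = k ·ₚ S n

_*ₚₛ_ : Poly → Series → Series
(p *ₚₛ S) n = p *ₚ S n

-- All coefficients involved are natural numbers with a closed form. A monomial of
-- degree m in the arguments f∘ (i times) and Q = f• w^γ (j times) splits into a
-- multiset of size a among the f∘'s and one of size b among the Q's, so the
-- coefficient of f∘^a f•^b w^c in h_m is [a + b = m] [c = bγ] multichoose i a
-- multichoose j b, and that of v^n/n! in φ is [i + j + a + b = n] [c = bγ]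
-- multichoose i a multichoose j b (γ = 1 gives φ_{i,j}; i = γ = 0 gives φ_j).
-- Each derivative then reduces to (a + 1) multichoose i (a + 1) = i multichoose (i + 1) a.
module Submission where

open import Defs
open import Data.Bool using (true; false)
open import Data.Integer using (ℤ; +_) renaming (_*_ to _*ℤ_)
open import Data.Integer.Properties using (pos-*)
open import Data.List using (List; []; _∷_; length; replicate; _++_)
open import Data.List.Properties using (length-++; length-replicate)
open import Data.Nat
  using (ℕ; zero; suc; _+_; _*_; _∸_; _≤_; _<_; _≥_; z≤n; s≤s; _≤′_; ≤′-refl; ≤′-step; _≤ᵇ_; _≟_; _≤?_)
open import Data.Nat.Properties
open import Data.Nat.Tactic.RingSolver using (solve-∀)
open import Data.Product using (_×_; _,_)
open import Function using (_∘_)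
open import Relation.Binary.PropositionalEquality
open import Relation.Nullary using (yes; no; contradiction)
open import Relation.Nullary.Reflects using (ofʸ; ofⁿ)

δ : ℕ → ℕ → ℕ
δ zero    zero    = 1
δ zero    (suc _) = 0
δ (suc _) zero    = 0
δ (suc m) (suc n) = δ m n

θ : ℕ → ℕ → ℕ
θ zero    _       = 1
θ (suc _) zero    = 0
θ (suc k) (suc n) = θ k n

δ-≢ : ∀ {m n} → m ≢ n → δ m n ≡ 0
δ-≢ {zero}  {zero}  m≢n = contradiction refl m≢n
δ-≢ {zero}  {suc _} _   = refl
δ-≢ {suc _} {zero}  _   = refl
δ-≢ {suc m} {suc n} m≢n = δ-≢ (m≢n ∘ cong suc)

δ-*-subst : ∀ m n (g : ℕ → ℕ) → δ m n * g n ≡ δ m n * g m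
δ-*-subst m n g with m ≟ n
... | yes refl = refl
... | no  m≢n  rewrite δ-≢ m≢n = refl

θ-≤ : ∀ {k n} → k ≤ n → θ k n ≡ 1
θ-≤ {zero}  _         = refl
θ-≤ {suc k} (s≤s k≤n) = θ-≤ k≤n

θ-> : ∀ {k n} → n < k → θ k n ≡ 0
θ-> {suc k} {zero}  _         = refl
θ-> {suc k} {suc n} (s≤s n<k) = θ-> n<k

θ-*-cong : ∀ {k n x y} → (k ≤ n → x ≡ y) → θ k n * x ≡ θ k n * y
θ-*-cong {k} {n} x≡y with k ≤? n
... | yes k≤n = cong (θ k n *_) (x≡y k≤n)
... | no  k≰n rewrite θ-> (≰⇒> k≰n) = refl

θ-suc : ∀ k n → θ k (suc n) ≡ θ k n + δ k (suc n)
θ-suc zero          n       = refl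
θ-suc (suc zero)    zero    = refl
θ-suc (suc (suc k)) zero    = refl
θ-suc (suc k)       (suc n) = θ-suc k n

θ-*-δ-∸ : ∀ k s n → θ k n * δ s (n ∸ k) ≡ δ (k + s) n
θ-*-δ-∸ zero    s n       = *-identityˡ (δ s n)
θ-*-δ-∸ (suc k) s zero    = refl
θ-*-δ-∸ (suc k) s (suc n) = θ-*-δ-∸ k s n

δ-∸ : ∀ {k n} s → k ≤ n → δ s (n ∸ k) ≡ δ (k + s) n
δ-∸ {k} {n} s k≤n = begin
  δ s (n ∸ k)              ≡⟨ sym (*-identityˡ _) ⟩
  1 * δ s (n ∸ k)          ≡⟨ cong (_* δ s (n ∸ k)) (sym (θ-≤ k≤n)) ⟩
  θ k n * δ s (n ∸ k)      ≡⟨ θ-*-δ-∸ k s n ⟩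
  δ (k + s) n              ∎
  where open ≡-Reasoning

sumToℕ : (ℕ → ℕ) → ℕ → ℕ
sumToℕ f zero    = f zero
sumToℕ f (suc m) = sumToℕ f m + f (suc m)

sumTo-+ : ∀ {f : ℕ → ℤ} {g : ℕ → ℕ} m → (∀ t → f t ≡ + g t) → sumTo f m ≡ + sumToℕ g m
sumTo-+ zero    f≡g = f≡g 0
sumTo-+ (suc m) f≡g rewrite sumTo-+ m f≡g | f≡g (suc m) = refl

sumToℕ-cong : ∀ {f g : ℕ → ℕ} m → (∀ t → t ≤ m → f t ≡ g t) → sumToℕ f m ≡ sumToℕ g m
sumToℕ-cong zero    f≡g = f≡g 0 z≤n
sumToℕ-cong (suc m) f≡g =
  cong₂ _+_ (sumToℕ-cong m (λ t t≤m → f≡g t (m≤n⇒m≤1+n t≤m))) (f≡g (suc m) ≤-refl)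

sumToℕ-*ˡ : ∀ k (f : ℕ → ℕ) m → sumToℕ (λ t → k * f t) m ≡ k * sumToℕ f m
sumToℕ-*ˡ k f zero    = refl
sumToℕ-*ˡ k f (suc m) =
  trans (cong (_+ k * f (suc m)) (sumToℕ-*ˡ k f m)) (sym (*-distribˡ-+ k (sumToℕ f m) (f (suc m))))

sumToℕ-*ʳ : ∀ k (f : ℕ → ℕ) m → sumToℕ (λ t → f t * k) m ≡ sumToℕ f m * k
sumToℕ-*ʳ k f zero    = refl
sumToℕ-*ʳ k f (suc m) =
  trans (cong (_+ f (suc m) * k) (sumToℕ-*ʳ k f m)) (sym (*-distribʳ-+ k (sumToℕ f m) (f (suc m))))

sumToℕ-shift : ∀ (f : ℕ → ℕ) m → sumToℕ f (suc m) ≡ f 0 + sumToℕ (f ∘ suc) m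
sumToℕ-shift f zero    = refl
sumToℕ-shift f (suc m) = trans (cong (_+ f (suc (suc m))) (sumToℕ-shift f m)) (+-assoc (f 0) _ _)

sumToℕ-δ : ∀ k (g : ℕ → ℕ) m → sumToℕ (λ t → δ k t * g t) m ≡ θ k m * g k
sumToℕ-δ zero    g zero    = refl
sumToℕ-δ (suc k) g zero    = refl
sumToℕ-δ k       g (suc m) = begin
  sumToℕ (λ t → δ k t * g t) m + δ k (suc m) * g (suc m)
    ≡⟨ cong₂ _+_ (sumToℕ-δ k g m) (δ-*-subst k (suc m) g) ⟩
  θ k m * g k + δ k (suc m) * g k
    ≡⟨ sym (*-distribʳ-+ (g k) (θ k m) (δ k (suc m))) ⟩
  (θ k m + δ k (suc m)) * g k
    ≡⟨ cong (_* g k) (sym (θ-suc k m)) ⟩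
  θ k (suc m) * g k ∎
  where open ≡-Reasoning

sumToℕ-*-δ : ∀ x n (g : ℕ → ℕ) m → sumToℕ (λ t → x * δ n t * g t) m ≡ x * (θ n m * g n)
sumToℕ-*-δ x n g m = begin
  sumToℕ (λ t → x * δ n t * g t) m      ≡⟨ sumToℕ-cong m (λ t _ → *-assoc x (δ n t) (g t)) ⟩
  sumToℕ (λ t → x * (δ n t * g t)) m    ≡⟨ sumToℕ-*ˡ x _ m ⟩
  x * sumToℕ (λ t → δ n t * g t) m      ≡⟨ cong (x *_) (sumToℕ-δ n g m) ⟩
  x * (θ n m * g n)                     ∎
  where open ≡-Reasoning

sumToℕ-θ : ∀ {k} m (g : ℕ → ℕ) → k ≤ m → sumToℕ (λ t → θ t k * g t) m ≡ sumToℕ g k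
sumToℕ-θ {k} m g k≤m = go (≤⇒≤′ k≤m)
  where
  go : ∀ {m} → k ≤′ m → sumToℕ (λ t → θ t k * g t) m ≡ sumToℕ g k
  go ≤′-refl = sumToℕ-cong k (λ t t≤k → trans (cong (_* g t) (θ-≤ t≤k)) (*-identityˡ (g t)))
  go (≤′-step {m} k≤′m) =
    trans (cong₂ _+_ (go k≤′m) (cong (_* g (suc m)) (θ-> (s≤s (≤′⇒≤ k≤′m))))) (+-identityʳ _)

-- The sum over t ≤ m may be cut at k once δ n m forces m = n ≥ k.
δ-*-sumToℕ-θ : ∀ {k n} m (g : ℕ → ℕ) (f : ℕ → ℕ) → k ≤ n →
  δ n m * f (sumToℕ (λ t → θ t k * g t) m) ≡ δ n m * f (sumToℕ g k)
δ-*-sumToℕ-θ {k} {n} m g f k≤n with n ≟ m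
... | yes refl = cong (λ s → δ n n * f s) (sumToℕ-θ n g k≤n)
... | no  n≢m  rewrite δ-≢ n≢m = refl

multichoose : ℕ → ℕ → ℕ
multichoose zero    a = δ 0 a
multichoose (suc i) a = sumToℕ (λ t → multichoose i (a ∸ t)) a

multichoose-zero : ∀ i → multichoose i 0 ≡ 1
multichoose-zero zero    = refl
multichoose-zero (suc i) = multichoose-zero i

multichoose-pascal : ∀ i a →
  multichoose (suc i) (suc a) ≡ multichoose i (suc a) + multichoose (suc i) a
multichoose-pascal i a = sumToℕ-shift (λ t → multichoose i (suc a ∸ t)) a

suc-*-multichoose : ∀ i a → suc a * multichoose i (suc a) ≡ i * multichoose (suc i) a
suc-*-multichoose zero    a = *-zeroʳ (suc a)
suc-*-multichoose (suc i) zero = begin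
  1 * multichoose (suc i) 1
    ≡⟨ cong (1 *_) (multichoose-pascal i 0) ⟩
  1 * (multichoose i 1 + multichoose (suc i) 0)
    ≡⟨ *-distribˡ-+ 1 (multichoose i 1) _ ⟩
  1 * multichoose i 1 + 1 * multichoose (suc i) 0
    ≡⟨ cong (_+ 1 * multichoose (suc i) 0) (suc-*-multichoose i 0) ⟩
  i * multichoose (suc i) 0 + 1 * multichoose (suc i) 0
    ≡⟨ sym (*-distribʳ-+ (multichoose (suc i) 0) i 1) ⟩
  (i + 1) * multichoose (suc i) 0
    ≡⟨ cong₂ _*_ (+-comm i 1) (trans (multichoose-zero (suc i)) (sym (multichoose-zero (suc (suc i))))) ⟩
  suc i * multichoose (suc (suc i)) 0 ∎
  where open ≡-Reasoning
suc-*-multichoose (suc i) (suc a) = begin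
  suc (suc a) * multichoose (suc i) (suc (suc a))
    ≡⟨ cong (suc (suc a) *_) (multichoose-pascal i (suc a)) ⟩
  suc (suc a) * (multichoose i (suc (suc a)) + M)
    ≡⟨ *-distribˡ-+ (suc (suc a)) (multichoose i (suc (suc a))) M ⟩
  suc (suc a) * multichoose i (suc (suc a)) + (M + suc a * M)
    ≡⟨ cong₂ (λ x y → x + (M + y)) (suc-*-multichoose i (suc a)) (suc-*-multichoose (suc i) a) ⟩
  i * M + (M + suc i * N)
    ≡⟨ regroup i M N ⟩
  suc i * (M + N)
    ≡⟨ cong (suc i *_) (sym (multichoose-pascal (suc i) a)) ⟩
  suc i * multichoose (suc (suc i)) (suc a) ∎
  where
  open ≡-Reasoning
  M = multichoose (suc i) (suc a)
  N = multichoose (suc (suc i)) a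
  regroup : ∀ i M N → i * M + (M + suc i * N) ≡ suc i * (M + N)
  regroup = solve-∀

infix 4 _HasCoeffs_
_HasCoeffs_ : Poly → (ℕ → ℕ → ℕ → ℕ) → Set
p HasCoeffs P = ∀ a b c → p a b c ≡ + P a b c

HasCoeffs-cong : ∀ {p P Q} → (∀ a b c → P a b c ≡ Q a b c) → p HasCoeffs P → p HasCoeffs Q
HasCoeffs-cong P≡Q hp a b c = trans (hp a b c) (cong +_ (P≡Q a b c))

HasCoeffs-≋ : ∀ {p q P Q} → p HasCoeffs P → q HasCoeffs Q → (∀ a b c → P a b c ≡ Q a b c) → p ≋ q
HasCoeffs-≋ hp hq P≡Q a b c = trans (hp a b c) (trans (cong +_ (P≡Q a b c)) (sym (hq a b c)))

+-*ℤ : ∀ k {z P} → z ≡ + P → + k *ℤ z ≡ + (k * P)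
+-*ℤ k {P = P} refl = sym (pos-* k P)

·ₚ-coeffs : ∀ k {p P} → p HasCoeffs P → (k ·ₚ p) HasCoeffs λ a b c → k * P a b c
·ₚ-coeffs k hp a b c = +-*ℤ k (hp a b c)

∂X-coeffs : ∀ {p P} → p HasCoeffs P → ∂X p HasCoeffs λ a b c → suc a * P (suc a) b c
∂X-coeffs hp a b c = +-*ℤ (suc a) (hp (suc a) b c)

∂Y-coeffs : ∀ {p P} → p HasCoeffs P → ∂Y p HasCoeffs λ a b c → suc b * P a (suc b) c
∂Y-coeffs hp a b c = +-*ℤ (suc b) (hp a (suc b) c)

Monomial : ℕ → ℕ → ℕ → Poly → Set
Monomial α β γ p = p HasCoeffs λ a b c → δ α a * δ β b * δ γ c

1ₚ-monomial : Monomial 0 0 0 1ₚ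
1ₚ-monomial zero    zero    zero    = refl
1ₚ-monomial zero    zero    (suc c) = refl
1ₚ-monomial zero    (suc b) c       = refl
1ₚ-monomial (suc a) b       c       = refl

Xₚ-monomial : Monomial 1 0 0 Xₚ
Xₚ-monomial zero          b       c       = refl
Xₚ-monomial (suc zero)    zero    zero    = refl
Xₚ-monomial (suc zero)    zero    (suc c) = refl
Xₚ-monomial (suc zero)    (suc b) c       = refl
Xₚ-monomial (suc (suc a)) b       c       = refl

Yₚ-monomial : Monomial 0 1 0 Yₚ
Yₚ-monomial zero    zero          c       = refl
Yₚ-monomial zero    (suc zero)    zero    = refl
Yₚ-monomial zero    (suc zero)    (suc c) = refl
Yₚ-monomial zero    (suc (suc b)) c       = refl
Yₚ-monomial (suc a) b             c       = refl

Wₚ-monomial : Monomial 0 0 1 Wₚ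
Wₚ-monomial zero    zero    zero          = refl
Wₚ-monomial zero    zero    (suc zero)    = refl
Wₚ-monomial zero    zero    (suc (suc c)) = refl
Wₚ-monomial zero    (suc b) c             = refl
Wₚ-monomial (suc a) b       c             = refl

*ₚ-coeffs : ∀ {p q P Q} → p HasCoeffs P → q HasCoeffs Q →
  (p *ₚ q) HasCoeffs λ a b c → sumToℕ (λ a₁ → sumToℕ (λ b₁ → sumToℕ (λ c₁ →
    P a₁ b₁ c₁ * Q (a ∸ a₁) (b ∸ b₁) (c ∸ c₁)) c) b) a
*ₚ-coeffs {P = P} {Q} hp hq a b c =
  sumTo-+ a λ a₁ → sumTo-+ b λ b₁ → sumTo-+ c λ c₁ →
    let a₂ = a ∸ a₁; b₂ = b ∸ b₁; c₂ = c ∸ c₁ in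
    trans (cong₂ _*ℤ_ (hp a₁ b₁ c₁) (hq a₂ b₂ c₂)) (sym (pos-* (P a₁ b₁ c₁) (Q a₂ b₂ c₂)))

monomial-*ₚ : ∀ {α β γ p q Q} → Monomial α β γ p → q HasCoeffs Q →
  (p *ₚ q) HasCoeffs λ a b c → θ α a * (θ β b * (θ γ c * Q (a ∸ α) (b ∸ β) (c ∸ γ)))
monomial-*ₚ {α} {β} {γ} {Q = Q} hp hq =
  HasCoeffs-cong collapse (*ₚ-coeffs {P = λ a b c → δ α a * δ β b * δ γ c} hp hq)
  where
  collapse : ∀ a b c →
    sumToℕ (λ a₁ → sumToℕ (λ b₁ → sumToℕ (λ c₁ →
      δ α a₁ * δ β b₁ * δ γ c₁ * Q (a ∸ a₁) (b ∸ b₁) (c ∸ c₁)) c) b) a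
    ≡ θ α a * (θ β b * (θ γ c * Q (a ∸ α) (b ∸ β) (c ∸ γ)))
  collapse a b c = begin
    sumToℕ (λ a₁ → sumToℕ (λ b₁ → sumToℕ (λ c₁ →
      δ α a₁ * δ β b₁ * δ γ c₁ * Q (a ∸ a₁) (b ∸ b₁) (c ∸ c₁)) c) b) a
      ≡⟨ sumToℕ-cong a (λ a₁ _ → sumToℕ-cong b λ b₁ _ →
           sumToℕ-*-δ (δ α a₁ * δ β b₁) γ (λ c₁ → Q (a ∸ a₁) (b ∸ b₁) (c ∸ c₁)) c) ⟩
    sumToℕ (λ a₁ → sumToℕ (λ b₁ → δ α a₁ * δ β b₁ * (θ γ c * Q (a ∸ a₁) (b ∸ b₁) (c ∸ γ))) b) a
      ≡⟨ sumToℕ-cong a (λ a₁ _ →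
           sumToℕ-*-δ (δ α a₁) β (λ b₁ → θ γ c * Q (a ∸ a₁) (b ∸ b₁) (c ∸ γ)) b) ⟩
    sumToℕ (λ a₁ → δ α a₁ * (θ β b * (θ γ c * Q (a ∸ a₁) (b ∸ β) (c ∸ γ)))) a
      ≡⟨ sumToℕ-δ α (λ a₁ → θ β b * (θ γ c * Q (a ∸ a₁) (b ∸ β) (c ∸ γ))) a ⟩
    θ α a * (θ β b * (θ γ c * Q (a ∸ α) (b ∸ β) (c ∸ γ))) ∎
    where open ≡-Reasoning

^ₚ-monomial : ∀ {α β γ p} t → Monomial α β γ p → Monomial (t * α) (t * β) (t * γ) (p ^ₚ t)
^ₚ-monomial zero    hp = 1ₚ-monomial
^ₚ-monomial {α} {β} {γ} (suc t) hp =
  HasCoeffs-cong collapse (monomial-*ₚ {α} {β} {γ} hp (^ₚ-monomial {α} {β} {γ} t hp))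
  where
  regroup : ∀ x y z u v w → x * (y * (z * (u * v * w))) ≡ x * u * (y * v) * (z * w)
  regroup = solve-∀
  collapse : ∀ a b c →
    θ α a * (θ β b * (θ γ c * (δ (t * α) (a ∸ α) * δ (t * β) (b ∸ β) * δ (t * γ) (c ∸ γ))))
    ≡ δ (α + t * α) a * δ (β + t * β) b * δ (γ + t * γ) c
  collapse a b c =
    trans (regroup (θ α a) (θ β b) (θ γ c) (δ (t * α) (a ∸ α)) (δ (t * β) (b ∸ β)) (δ (t * γ) (c ∸ γ)))
    (cong₂ _*_ (cong₂ _*_ (θ-*-δ-∸ α _ a) (θ-*-δ-∸ β _ b)) (θ-*-δ-∸ γ _ c))

Xₚ^-monomial : ∀ t → Monomial t 0 0 (Xₚ ^ₚ t)
Xₚ^-monomial t =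
  subst₂ (λ α β → Monomial α β β (Xₚ ^ₚ t)) (*-identityʳ t) (*-zeroʳ t)
    (^ₚ-monomial {1} {0} {0} t Xₚ-monomial)

Q^ₚ-monomial : ∀ {γ Q} → Monomial 0 1 γ Q → ∀ t → Monomial 0 t (t * γ) (Q ^ₚ t)
Q^ₚ-monomial {γ} {Q} hQ t =
  subst₂ (λ α β → Monomial α β (t * γ) (Q ^ₚ t)) (*-zeroʳ t) (*-identityʳ t)
    (^ₚ-monomial {0} {1} {γ} t hQ)

Wₚ-*ₚ-coeffs : ∀ {p P} → p HasCoeffs P → (Wₚ *ₚ p) HasCoeffs λ a b c → θ 1 c * P a b (c ∸ 1)
Wₚ-*ₚ-coeffs hp =
  HasCoeffs-cong (λ a b c → trans (*-identityˡ _) (*-identityˡ _))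
    (monomial-*ₚ {0} {0} {1} Wₚ-monomial hp)

WₚYₚ-monomial : Monomial 0 1 1 (Wₚ *ₚ Yₚ)
WₚYₚ-monomial =
  HasCoeffs-cong collapse (Wₚ-*ₚ-coeffs {P = λ a b c → δ 0 a * δ 1 b * δ 0 c} Yₚ-monomial)
  where
  regroup : ∀ x u v w → x * (u * v * w) ≡ u * v * (x * w)
  regroup = solve-∀
  collapse : ∀ a b c → θ 1 c * (δ 0 a * δ 1 b * δ 0 (c ∸ 1)) ≡ δ 0 a * δ 1 b * δ 1 c
  collapse a b c = trans (regroup (θ 1 c) (δ 0 a) (δ 1 b) (δ 0 (c ∸ 1)))
    (cong (δ 0 a * δ 1 b *_) (θ-*-δ-∸ 1 0 c))

h-∷ : ∀ m x xs → h m (x ∷ xs) ≋ sumPoly (λ t → (x ^ₚ t) *ₚ h (m ∸ t) xs) m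
h-∷ zero    x xs a b c = refl
h-∷ (suc m) x xs a b c = refl

h-∷-coeffs : ∀ {x : Poly} {xs : List Poly} {F : ℕ → ℕ → ℕ → ℕ → ℕ} (α β γ : ℕ → ℕ) →
  (∀ t → Monomial (α t) (β t) (γ t) (x ^ₚ t)) →
  (∀ m → h m xs HasCoeffs F m) → ∀ m →
  h m (x ∷ xs) HasCoeffs λ a b c →
    sumToℕ (λ t → θ (α t) a * (θ (β t) b * (θ (γ t) c * F (m ∸ t) (a ∸ α t) (b ∸ β t) (c ∸ γ t)))) m
h-∷-coeffs α β γ x^-monomial hxs m a b c =
  trans (h-∷ m _ _ a b c)
    (sumTo-+ m (λ t → monomial-*ₚ {α t} {β t} {γ t} (x^-monomial t) (hxs (m ∸ t)) a b c))

hCoeff : ℕ → ℕ → ℕ → ℕ → ℕ → ℕ → ℕ → ℕ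
hCoeff γ i j m a b c = δ (a + b) m * (δ (b * γ) c * (multichoose i a * multichoose j b))

m*[n*0]≡0 : ∀ m n → m * (n * 0) ≡ 0
m*[n*0]≡0 = solve-∀

h-[]-coeffs : ∀ γ m → h m [] HasCoeffs hCoeff γ 0 0 m
h-[]-coeffs γ zero    zero    zero    zero    = refl
h-[]-coeffs γ zero    zero    zero    (suc c) = refl
h-[]-coeffs γ zero    (suc a) b       c       = refl
h-[]-coeffs γ zero    zero    (suc b) c       = refl
h-[]-coeffs γ (suc m) zero    zero    c       = refl
h-[]-coeffs γ (suc m) (suc a) b       c       = cong +_ (sym (m*[n*0]≡0 (δ (a + b) m) (δ (b * γ) c)))
h-[]-coeffs γ (suc m) zero    (suc b) c       = cong +_ (sym (m*[n*0]≡0 (δ b m) (δ (γ + b * γ) c)))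

hCoeff-X-step : ∀ γ i j m a b c →
  sumToℕ (λ t → θ t a * (1 * (1 * hCoeff γ i j (m ∸ t) (a ∸ t) b c))) m ≡ hCoeff γ (suc i) j m a b c
hCoeff-X-step γ i j m a b c = begin
  sumToℕ (λ t → θ t a * (1 * (1 * hCoeff γ i j (m ∸ t) (a ∸ t) b c))) m
    ≡⟨ sumToℕ-cong m term ⟩
  sumToℕ (λ t → D * (E * (θ t a * multichoose i (a ∸ t) * B))) m
    ≡⟨ sumToℕ-*ˡ D _ m ⟩
  D * sumToℕ (λ t → E * (θ t a * multichoose i (a ∸ t) * B)) m
    ≡⟨ cong (D *_) (trans (sumToℕ-*ˡ E _ m) (cong (E *_) (sumToℕ-*ʳ B _ m))) ⟩
  D * (E * (sumToℕ (λ t → θ t a * multichoose i (a ∸ t)) m * B))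
    ≡⟨ δ-*-sumToℕ-θ m (λ t → multichoose i (a ∸ t)) (λ s → E * (s * B)) (m≤m+n a b) ⟩
  D * (E * (multichoose (suc i) a * B)) ∎
  where
  open ≡-Reasoning
  D = δ (a + b) m
  E = δ (b * γ) c
  B = multichoose j b
  regroup : ∀ x d e y z → x * (1 * (1 * (d * (e * (y * z))))) ≡ d * (e * (x * y * z))
  regroup = solve-∀
  term : ∀ t → t ≤ m →
    θ t a * (1 * (1 * hCoeff γ i j (m ∸ t) (a ∸ t) b c)) ≡ D * (E * (θ t a * multichoose i (a ∸ t) * B))
  term t t≤m = trans
    (θ-*-cong {t} {a} λ t≤a → cong (λ d → 1 * (1 * (d * (E * (multichoose i (a ∸ t) * B)))))
      (trans (δ-∸ _ t≤m) (cong (λ s → δ s m)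
        (trans (sym (+-assoc t (a ∸ t) b)) (cong (_+ b) (m+[n∸m]≡n t≤a))))))
    (regroup (θ t a) D E (multichoose i (a ∸ t)) B)

hCoeff-Q-step : ∀ γ j m a b c →
  sumToℕ (λ t → 1 * (θ t b * (θ (t * γ) c * hCoeff γ 0 j (m ∸ t) a (b ∸ t) (c ∸ t * γ)))) m
  ≡ hCoeff γ 0 (suc j) m a b c
hCoeff-Q-step γ j m a b c = begin
  sumToℕ (λ t → 1 * (θ t b * (θ (t * γ) c * hCoeff γ 0 j (m ∸ t) a (b ∸ t) (c ∸ t * γ)))) m
    ≡⟨ sumToℕ-cong m term ⟩
  sumToℕ (λ t → D * (E * (A * (θ t b * multichoose j (b ∸ t))))) m
    ≡⟨ sumToℕ-*ˡ D _ m ⟩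
  D * sumToℕ (λ t → E * (A * (θ t b * multichoose j (b ∸ t)))) m
    ≡⟨ cong (D *_) (trans (sumToℕ-*ˡ E _ m) (cong (E *_) (sumToℕ-*ˡ A _ m))) ⟩
  D * (E * (A * sumToℕ (λ t → θ t b * multichoose j (b ∸ t)) m))
    ≡⟨ δ-*-sumToℕ-θ m (λ t → multichoose j (b ∸ t)) (λ s → E * (A * s)) (m≤n+m b a) ⟩
  D * (E * (A * multichoose (suc j) b)) ∎
  where
  open ≡-Reasoning
  D = δ (a + b) m
  E = δ (b * γ) c
  A = multichoose 0 a
  regroupˡ : ∀ x u d e y z → 1 * (x * (u * (d * (e * (y * z))))) ≡ x * (d * ((u * e) * (y * z)))
  regroupˡ = solve-∀
  regroupʳ : ∀ x d e y z → x * (d * (e * (y * z))) ≡ d * (e * (y * (x * z)))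
  regroupʳ = solve-∀
  term : ∀ t → t ≤ m →
    1 * (θ t b * (θ (t * γ) c * hCoeff γ 0 j (m ∸ t) a (b ∸ t) (c ∸ t * γ)))
    ≡ D * (E * (A * (θ t b * multichoose j (b ∸ t))))
  term t t≤m = begin
    1 * (θ t b * (θ (t * γ) c * hCoeff γ 0 j (m ∸ t) a (b ∸ t) (c ∸ t * γ)))
      ≡⟨ regroupˡ (θ t b) (θ (t * γ) c) D′ E′ A Bₜ ⟩
    θ t b * (D′ * (θ (t * γ) c * E′ * (A * Bₜ)))
      ≡⟨ θ-*-cong {t} {b} (λ t≤b → cong₂ (λ d e → d * (e * (A * Bₜ))) (δ-a+b t≤b) (δ-b*γ t≤b)) ⟩
    θ t b * (D * (E * (A * Bₜ)))
      ≡⟨ regroupʳ (θ t b) D E A Bₜ ⟩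
    D * (E * (A * (θ t b * Bₜ))) ∎
    where
    D′ = δ (a + (b ∸ t)) (m ∸ t)
    E′ = δ ((b ∸ t) * γ) (c ∸ t * γ)
    Bₜ = multichoose j (b ∸ t)
    δ-a+b : t ≤ b → D′ ≡ D
    δ-a+b t≤b = trans (δ-∸ _ t≤m) (cong (λ s → δ s m)
      (trans (+-comm t _) (trans (+-assoc a (b ∸ t) t) (cong (_+_ a) (m∸n+n≡m t≤b)))))
    δ-b*γ : t ≤ b → θ (t * γ) c * E′ ≡ E
    δ-b*γ t≤b = trans (θ-*-δ-∸ (t * γ) _ c) (cong (λ s → δ s c)
      (trans (sym (*-distribʳ-+ γ t (b ∸ t))) (cong (_* γ) (m+[n∸m]≡n t≤b))))

h-coeffs : ∀ {γ Q} → Monomial 0 1 γ Q →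
  ∀ i j m → h m (replicate i Xₚ ++ replicate j Q) HasCoeffs hCoeff γ i j m
h-coeffs {γ} hQ zero    zero    m = h-[]-coeffs γ m
h-coeffs {γ} hQ zero    (suc j) m = HasCoeffs-cong (hCoeff-Q-step γ j m)
  (h-∷-coeffs {F = hCoeff γ 0 j} (λ _ → 0) (λ t → t) (_* γ) (Q^ₚ-monomial hQ) (h-coeffs {γ} hQ zero j) m)
h-coeffs {γ} hQ (suc i) j       m = HasCoeffs-cong (hCoeff-X-step γ i j m)
  (h-∷-coeffs {F = hCoeff γ i j} (λ t → t) (λ _ → 0) (λ _ → 0) Xₚ^-monomial (h-coeffs {γ} hQ i j) m)

φ-coeffs : ∀ {xs : List Poly} {F : ℕ → ℕ → ℕ → ℕ → ℕ} → (∀ m → h m xs HasCoeffs F m) →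
  ∀ n → φ xs n HasCoeffs λ a b c → θ (length xs) n * F (n ∸ length xs) a b c
φ-coeffs {xs} hxs n a b c with length xs ≤ᵇ n | ≤ᵇ-reflects-≤ (length xs) n
... | true  | ofʸ k≤n rewrite θ-≤ k≤n = trans (hxs (n ∸ length xs) a b c) (cong +_ (sym (*-identityˡ _)))
... | false | ofⁿ k≰n rewrite θ-> (≰⇒> k≰n) = refl

φCoeff : ℕ → ℕ → ℕ → ℕ → ℕ → ℕ → ℕ → ℕ
φCoeff γ i j n a b c = δ (i + j + (a + b)) n * (δ (b * γ) c * (multichoose i a * multichoose j b))

φ-replicate-coeffs : ∀ {γ Q} → Monomial 0 1 γ Q →
  ∀ i j n → φ (replicate i Xₚ ++ replicate j Q) n HasCoeffs φCoeff γ i j n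
φ-replicate-coeffs {γ} {Q} hQ i j n = HasCoeffs-cong merge (φ-coeffs (h-coeffs hQ i j) n)
  where
  length-args : length (replicate i Xₚ ++ replicate j Q) ≡ i + j
  length-args = trans (length-++ (replicate i Xₚ)) (cong₂ _+_ (length-replicate i) (length-replicate j))
  merge : ∀ a b c → θ (length (replicate i Xₚ ++ replicate j Q)) n *
    hCoeff γ i j (n ∸ length (replicate i Xₚ ++ replicate j Q)) a b c ≡ φCoeff γ i j n a b c
  merge a b c rewrite length-args =
    trans (sym (*-assoc (θ (i + j) n) _ _)) (cong (_* _) (θ-*-δ-∸ (i + j) (a + b) n))

φ₂-coeffs : ∀ i j n → φ₂ i j n HasCoeffs φCoeff 1 i j n
φ₂-coeffs = φ-replicate-coeffs WₚYₚ-monomial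

φ₁-coeffs : ∀ i n → φ₁ i n HasCoeffs φCoeff 0 0 i n
φ₁-coeffs = φ-replicate-coeffs Yₚ-monomial 0

suc-*-φCoeff-X : ∀ γ i j n a b c → suc a * φCoeff γ i j n (suc a) b c ≡ i * φCoeff γ (suc i) j n a b c
suc-*-φCoeff-X γ i j n a b c rewrite +-suc (i + j) (a + b) = begin
  suc a * (D * (E * (multichoose i (suc a) * B)))   ≡⟨ regroup (suc a) D E (multichoose i (suc a)) B ⟩
  D * (E * (suc a * multichoose i (suc a) * B))     ≡⟨ cong (λ x → D * (E * (x * B))) (suc-*-multichoose i a) ⟩
  D * (E * (i * multichoose (suc i) a * B))         ≡⟨ sym (regroup i D E (multichoose (suc i) a) B) ⟩
  i * (D * (E * (multichoose (suc i) a * B)))       ∎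
  where
  open ≡-Reasoning
  D = δ (suc (i + j + (a + b))) n
  E = δ (b * γ) c
  B = multichoose j b
  regroup : ∀ x d e y z → x * (d * (e * (y * z))) ≡ d * (e * (x * y * z))
  regroup = solve-∀

suc-*-φCoeff-Y : ∀ γ i j n a b c →
  suc b * φCoeff γ i j n a (suc b) c ≡ j * (θ γ c * φCoeff γ i (suc j) n a b (c ∸ γ))
suc-*-φCoeff-Y γ i j n a b c
  rewrite +-suc a b | +-suc i j | +-suc (i + j) (a + b) = begin
  suc b * (D * (δ (γ + b * γ) c * (A * multichoose j (suc b))))
    ≡⟨ cong (λ e → suc b * (D * (e * (A * multichoose j (suc b))))) (sym (θ-*-δ-∸ γ (b * γ) c)) ⟩
  suc b * (D * (θ γ c * E * (A * multichoose j (suc b))))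
    ≡⟨ regroupˡ (suc b) D (θ γ c * E) A (multichoose j (suc b)) ⟩
  D * (θ γ c * E * (A * (suc b * multichoose j (suc b))))
    ≡⟨ cong (λ x → D * (θ γ c * E * (A * x))) (suc-*-multichoose j b) ⟩
  D * (θ γ c * E * (A * (j * multichoose (suc j) b)))
    ≡⟨ regroupʳ j (θ γ c) D E A (multichoose (suc j) b) ⟩
  j * (θ γ c * (D * (E * (A * multichoose (suc j) b)))) ∎
  where
  open ≡-Reasoning
  D = δ (suc (i + j + (a + b))) n
  E = δ (b * γ) (c ∸ γ)
  A = multichoose i a
  regroupˡ : ∀ x d e y z → x * (d * (e * (y * z))) ≡ d * (e * (y * (x * z)))
  regroupˡ = solve-∀
  regroupʳ : ∀ x u d e y z → d * (u * e * (y * (x * z))) ≡ x * (u * (d * (e * (y * z))))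
  regroupʳ = solve-∀

∂Xₛ-φ₂ : ∀ i j → ∂Xₛ (φ₂ i j) ≋ₛ i ·ₛ φ₂ (suc i) j
∂Xₛ-φ₂ i j n = HasCoeffs-≋ (∂X-coeffs (φ₂-coeffs i j n)) (·ₚ-coeffs i (φ₂-coeffs (suc i) j n))
  (suc-*-φCoeff-X 1 i j n)

∂Yₛ-φ₂ : ∀ i j → ∂Yₛ (φ₂ i j) ≋ₛ j ·ₛ (Wₚ *ₚₛ φ₂ i (suc j))
∂Yₛ-φ₂ i j n = HasCoeffs-≋ (∂Y-coeffs (φ₂-coeffs i j n))
  (·ₚ-coeffs j (Wₚ-*ₚ-coeffs (φ₂-coeffs i (suc j) n))) (suc-*-φCoeff-Y 1 i j n)

∂Yₛ-φ₁ : ∀ i → ∂Yₛ (φ₁ i) ≋ₛ i ·ₛ φ₁ (suc i)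
∂Yₛ-φ₁ i n = HasCoeffs-≋ (∂Y-coeffs (φ₁-coeffs i n)) (·ₚ-coeffs i (φ₁-coeffs (suc i) n))
  (λ a b c → trans (suc-*-φCoeff-Y 0 0 i n a b c) (cong (i *_) (*-identityˡ _)))

-- The identities hold for all i and j.
mainTheorem8 : (i j : ℕ) → i ≥ 1 → j ≥ 1 →
    (∂Xₛ (φ₂ i j) ≋ₛ i ·ₛ φ₂ (ℕ.suc i) j)
    × (∂Yₛ (φ₂ i j) ≋ₛ j ·ₛ (Wₚ *ₚₛ φ₂ i (ℕ.suc j)))
    × (∂Yₛ (φ₁ i) ≋ₛ i ·ₛ φ₁ (ℕ.suc i))
mainTheorem8 i j _ _ = ∂Xₛ-φ₂ i j , ∂Yₛ-φ₂ i j , ∂Yₛ-φ₁ i
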